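{- Let $F_i$ be the Fibonacci numbers with $F_0=0$, $F_1=1$, $F_i=F_{i-1}+F_{i-2}$, and let $J_n$ denote the number of subsets of $V(P_n)$ (including $\emptyset$ and $V(P_n)$) that are $0_2$-invoking, where $P_n$ is the path on $n$ vertices. Then $J_{k+1}=2(F_k+1)$ for all $k\ge 0$.
   Context: Diffusion on a finite simple graph $G$: a configuration assigns an integer stack size $|v|$ to each vertex; firing a configuration $C$ changes each $v$ simultaneously from $|v|^C$ to $|v|^C + |\{u\in N(v): |u|^C>|v|^C\}| - |\{u\in N(v): |u|^C<|v|^C\}|$. The 0-configuration has all stack sizes $0$. A perturbation of $H\subseteq V(G)$ from the 0-configuration is the step in which every vertex of $H$ sends one chip to each of its neighbours. $H$ is $0_2$-invoking if this perturbation followed by one ordinary firing yields the 0-configuration. -}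

module Defs where

open import Data.Nat as ℕ using (ℕ; zero; suc)
open import Data.Integer as ℤ using (ℤ; +_; _-_; _<?_)
open import Data.Fin using (Fin; toℕ)
open import Data.Bool using (Bool; true; false; if_then_else_)
open import Data.Vec using (Vec; []; _∷_; lookup)
open import Data.List using (List; []; _∷_; map; _++_; filter; length; sum; allFin)
open import Data.Product using (_×_)
open import Relation.Nullary using (¬_; Dec; does)
open import Relation.Binary.PropositionalEquality using (_≡_; sym)
open import Data.Sum using (_⊎_; inj₁; inj₂)
open import Relation.Nullary.Decidable using (_⊎-dec_)
import Data.Nat.Properties as ℕP
import Data.Bool
import Data.Fin.Properties
open import Relation.Unary using (Decidable)
open import Data.Fin.Subset using (Subset)

record Graph (n : ℕ) : Set₁ where
  field
    Adj     : Fin n → Fin n → Set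
    adj?    : ∀ u v → Dec (Adj u v)
    symm    : ∀ {u v} → Adj u v → Adj v u
    irrefl  : ∀ {v} → ¬ Adj v v
open Graph public

Config : ℕ → Set
Config n = Fin n → ℤ

countNbrs : ∀ {n} → Graph n → Fin n → (Fin n → Bool) → ℕ
countNbrs G v p = length (filter (λ u → adj? G v u) (filter (λ u → p u Data.Bool.≟ true) (allFin _)))

fire : ∀ {n} → Graph n → Config n → Config n
fire G C v =
  (C v ℤ.+ + countNbrs G v (λ u → does (C v <? C u)))
  - + countNbrs G v (λ u → does (C u <? C v))

zeroConfig : ∀ {n} → Config n
zeroConfig _ = + 0

-- perturbation of H from the 0-configuration:
-- every vertex of H sends one chip to each of its neighbours.
perturb : ∀ {n} → Graph n → Subset n → Config n
perturb G H v =
  + countNbrs G v (λ u → lookup H u)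
  - (if lookup H v then + countNbrs G v (λ _ → true) else + 0)

IsZeroConfig : ∀ {n} → Config n → Set
IsZeroConfig C = ∀ v → C v ≡ + 0

zeroConfig? : ∀ {n} (C : Config n) → Dec (IsZeroConfig C)
zeroConfig? C = Data.Fin.Properties.all? (λ v → C v ℤ.≟ + 0)

ZeroTwoInvoking : ∀ {n} → Graph n → Subset n → Set
ZeroTwoInvoking G H = IsZeroConfig (fire G (perturb G H))

zeroTwoInvoking? : ∀ {n} (G : Graph n) → Decidable (ZeroTwoInvoking G)
zeroTwoInvoking? G H = zeroConfig? (fire G (perturb G H))

allSubsets : (n : ℕ) → List (Subset n)
allSubsets zero = [] ∷ []
allSubsets (suc n) = map (true ∷_) (allSubsets n) ++ map (false ∷_) (allSubsets n)

PathAdj : ∀ {n} → Fin n → Fin n → Set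
PathAdj i j = (suc (toℕ i) ≡ toℕ j) ⊎ (suc (toℕ j) ≡ toℕ i)

pathAdj? : ∀ {n} (i j : Fin n) → Dec (PathAdj i j)
pathAdj? i j = (suc (toℕ i) ℕ.≟ toℕ j) ⊎-dec (suc (toℕ j) ℕ.≟ toℕ i)

pathSymm : ∀ {n} {i j : Fin n} → PathAdj i j → PathAdj j i
pathSymm (inj₁ p) = inj₂ p
pathSymm (inj₂ p) = inj₁ p

pathIrrefl : ∀ {n} {i : Fin n} → ¬ PathAdj i i
pathIrrefl (inj₁ p) = ℕP.<-irrefl (sym p) (ℕP.n<1+n _)
pathIrrefl (inj₂ p) = ℕP.<-irrefl (sym p) (ℕP.n<1+n _)

P : (n : ℕ) → Graph n
P n = record { Adj = PathAdj ; adj? = pathAdj? ; symm = pathSymm ; irrefl = pathIrrefl }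

fib : ℕ → ℕ
fib 0 = 0
fib 1 = 1
fib (suc (suc n)) = fib (suc n) ℕ.+ fib n

numInvoking : ∀ {n} → Graph n → ℕ
numInvoking {n} G = length (filter (zeroTwoInvoking? G) (allSubsets n))

J : ℕ → ℕ
J n = numInvoking (P n)

-- On the path, the value at vertex i after the perturbation and one firing depends only on
-- positions i − 2, …, i + 2: which of them are vertices and which lie in H. So H is
-- 0₂-invoking iff every window of five consecutive positions passes a local test, and a finite
-- automaton remembering the last four positions read accepts exactly the 0₂-invoking sets.
-- From every state, the number of accepted words of length m is α + β F_m + γ F_{m+1}: the
-- coefficients are read off at m = 0, 1, 2 and the Fibonacci recurrence is checked on all
-- states by evaluation. The two start states each contribute 1 + F_k.
module Submission where

open import Defs
open import Data.Nat using (ℕ; zero; suc; _+_; _*_; _∸_; _≡ᵇ_)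
import Data.Nat as ℕ
open import Data.Nat.Properties using (+-identityʳ; +-comm)
open import Data.Nat.ListAction using (sum)
open import Data.Nat.ListAction.Properties using (sum-++)
open import Data.Nat.Tactic.RingSolver using (solve-∀)
open import Data.Bool using (Bool; true; false; _∧_; _∨_; T; if_then_else_)
import Data.Bool as Bool
open import Data.Bool.Properties using (T-∧; ∧-zeroʳ; ∧-identityʳ)
open import Data.Vec using (Vec; []; _∷_; lookup)
open import Data.List using (List; []; _∷_; map; _++_; filter; length; allFin)
open import Data.List.Properties using (map-++; map-∘; map-cong; map-tabulate)
open import Data.Fin using (Fin; toℕ) renaming (zero to fzero; suc to fsuc)
open import Data.Maybe using (Maybe; just; nothing)
open import Data.Integer using (ℤ; _<?_)
import Data.Integer as ℤ
open import Data.Product using (_×_; _,_; proj₁; proj₂)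
open import Data.Product.Properties using (≡-dec)
open import Data.Unit using (tt)
open import Function using (_∘_; id; _⇔_; mk⇔; Equivalence)
open import Relation.Nullary using (does)
open import Relation.Nullary.Decidable using (does-⇔; T?; isYes; toWitness; fromWitness)
open import Relation.Unary using (Decidable)
open import Relation.Binary.PropositionalEquality
  using (_≡_; _≗_; refl; sym; trans; cong; cong₂; module ≡-Reasoning)

bit : Bool → ℕ
bit false = 0
bit true  = 1

count : {A : Set} → (A → Bool) → List A → ℕ
count p xs = sum (map (bit ∘ p) xs)

count-cong : ∀ {A : Set} {p q : A → Bool} → p ≗ q → ∀ xs → count p xs ≡ count q xs
count-cong p≗q xs = cong sum (map-cong (cong bit ∘ p≗q) xs)

count-++ : ∀ {A : Set} (p : A → Bool) xs ys → count p (xs ++ ys) ≡ count p xs + count p ys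
count-++ p xs ys = trans (cong sum (map-++ (bit ∘ p) xs ys)) (sum-++ (map (bit ∘ p) xs) _)

count-map : ∀ {A B : Set} (p : B → Bool) (f : A → B) xs → count p (map f xs) ≡ count (p ∘ f) xs
count-map p f xs = cong sum (sym (map-∘ xs))

count-false : ∀ {A : Set} (xs : List A) → count (λ _ → false) xs ≡ 0
count-false []       = refl
count-false (x ∷ xs) = count-false xs

count-+ : ∀ {A : Set} (f g h : A → Bool) → (∀ x → bit (f x) ≡ bit (g x) + bit (h x)) →
  ∀ xs → count f xs ≡ count g xs + count h xs
count-+ f g h split []       = refl
count-+ f g h split (x ∷ xs) = begin
  bit (f x) + count f xs                                  ≡⟨ cong₂ _+_ (split x) (count-+ f g h split xs) ⟩
  (bit (g x) + bit (h x)) + (count g xs + count h xs)     ≡⟨ interchange (bit (g x)) _ _ _ ⟩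
  (bit (g x) + count g xs) + (bit (h x) + count h xs)     ∎
  where
  open ≡-Reasoning
  interchange : ∀ a b c d → (a + b) + (c + d) ≡ (a + c) + (b + d)
  interchange = solve-∀

count-allFin-suc : ∀ {n} (p : Fin (suc n) → Bool) →
  count p (allFin (suc n)) ≡ bit (p fzero) + count (p ∘ fsuc) (allFin n)
count-allFin-suc {n} p =
  cong (bit (p fzero) +_) (trans (cong (count p) (sym (map-tabulate id fsuc))) (count-map p fsuc (allFin n)))

module _ {A : Set} {P : A → Set} (P? : Decidable P) where

  count-filter : ∀ (p : A → Bool) xs → count p (filter P? xs) ≡ count (λ x → does (P? x) ∧ p x) xs
  count-filter p []       = refl
  count-filter p (x ∷ xs) with does (P? x)
  ... | true  = cong (bit (p x) +_) (count-filter p xs)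
  ... | false = count-filter p xs

  length-filter≡count : ∀ xs → length (filter P? xs) ≡ count (does ∘ P?) xs
  length-filter≡count []       = refl
  length-filter≡count (x ∷ xs) with does (P? x)
  ... | true  = cong suc (length-filter≡count xs)
  ... | false = length-filter≡count xs

count-allSubsets-suc : ∀ {n} (p : Vec Bool (suc n) → Bool) →
  count p (allSubsets (suc n)) ≡ count (p ∘ (true ∷_)) (allSubsets n) + count (p ∘ (false ∷_)) (allSubsets n)
count-allSubsets-suc {n} p = begin
  count p (map (true ∷_) (allSubsets n) ++ map (false ∷_) (allSubsets n))
    ≡⟨ count-++ p (map (true ∷_) (allSubsets n)) _ ⟩
  count p (map (true ∷_) (allSubsets n)) + count p (map (false ∷_) (allSubsets n))
    ≡⟨ cong₂ _+_ (count-map p (true ∷_) (allSubsets n)) (count-map p (false ∷_) (allSubsets n)) ⟩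
  count (p ∘ (true ∷_)) (allSubsets n) + count (p ∘ (false ∷_)) (allSubsets n) ∎
  where open ≡-Reasoning

FibForm : Set
FibForm = ℕ × ℕ × ℕ

⟦_⟧ : FibForm → ℕ → ℕ
⟦ α , β , γ ⟧ m = α + β * fib m + γ * fib (suc m)

shift : FibForm → FibForm
shift (α , β , γ) = α , γ , β + γ

_⊕_ : FibForm → FibForm → FibForm
(α , β , γ) ⊕ (α′ , β′ , γ′) = α + α′ , β + β′ , γ + γ′

⟦⟧-suc : ∀ c m → ⟦ c ⟧ (suc m) ≡ ⟦ shift c ⟧ m
⟦⟧-suc (α , β , γ) m = identity α β γ (fib m) (fib (suc m))
  where
  identity : ∀ α β γ f f′ → α + β * f′ + γ * (f′ + f) ≡ α + γ * f + (β + γ) * f′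
  identity = solve-∀

⟦⟧-⊕ : ∀ c d m → ⟦ c ⟧ m + ⟦ d ⟧ m ≡ ⟦ c ⊕ d ⟧ m
⟦⟧-⊕ (α , β , γ) (α′ , β′ , γ′) m = identity α β γ α′ β′ γ′ (fib m) (fib (suc m))
  where
  identity : ∀ α β γ α′ β′ γ′ f f′ →
    (α + β * f + γ * f′) + (α′ + β′ * f + γ′ * f′) ≡ (α + α′) + (β + β′) * f + (γ + γ′) * f′
  identity = solve-∀

module Automaton {S : Set} (step : S → Bool → S) (final : S → Bool) where

  accepts : ∀ {m} → S → Vec Bool m → Bool
  accepts s []      = final s
  accepts s (x ∷ w) = accepts (step s x) w

  acceptCount : ℕ → S → ℕ
  acceptCount m s = count (accepts s) (allSubsets m)

  acceptCount-suc : ∀ m s → acceptCount (suc m) s ≡ acceptCount m (step s true) + acceptCount m (step s false)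
  acceptCount-suc m s = count-allSubsets-suc {m} (accepts s)

  acceptCount-fibForm : (form : S → FibForm) →
    (∀ s → acceptCount 0 s ≡ ⟦ form s ⟧ 0) →
    (∀ s → form (step s true) ⊕ form (step s false) ≡ shift (form s)) →
    ∀ m s → acceptCount m s ≡ ⟦ form s ⟧ m
  acceptCount-fibForm form base recurrence zero    s = base s
  acceptCount-fibForm form base recurrence (suc m) s = begin
    acceptCount (suc m) s                                       ≡⟨ acceptCount-suc m s ⟩
    acceptCount m (step s true) + acceptCount m (step s false)  ≡⟨ cong₂ _+_ (ih (step s true)) (ih (step s false)) ⟩
    ⟦ form (step s true) ⟧ m + ⟦ form (step s false) ⟧ m        ≡⟨ ⟦⟧-⊕ (form (step s true)) _ m ⟩
    ⟦ form (step s true) ⊕ form (step s false) ⟧ m              ≡⟨ cong (λ c → ⟦ c ⟧ m) (recurrence s) ⟩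
    ⟦ shift (form s) ⟧ m                                        ≡⟨ sym (⟦⟧-suc (form s) m) ⟩
    ⟦ form s ⟧ (suc m)                                          ∎
    where
    open ≡-Reasoning
    ih : ∀ s → acceptCount m s ≡ ⟦ form s ⟧ m
    ih = acceptCount-fibForm form base recurrence m

Cell : Set
Cell = Maybe Bool

member : Cell → Bool
member nothing  = false
member (just x) = x

onVertex : Cell → Bool → ℕ
onVertex nothing  _ = 0
onVertex (just _) b = bit b

infixr 5 _◂_
_◂_ : Cell → (ℕ → Cell) → ℕ → Cell
(c ◂ s) zero    = c
(c ◂ s) (suc i) = s i

cells : ∀ {n} → Vec Bool n → ℕ → Cell
cells []      = λ _ → nothing
cells (x ∷ H) = just x ◂ cells H

-- Vertex i of P_n sits at position 2 + i; positions off the path hold nothing.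
padded : ∀ {n} → Vec Bool n → ℕ → Cell
padded H = nothing ◂ nothing ◂ cells H

cells-lookup : ∀ {n} (H : Vec Bool n) (u : Fin n) → cells H (toℕ u) ≡ just (lookup H u)
cells-lookup (x ∷ H) fzero    = refl
cells-lookup (x ∷ H) (fsuc u) = cells-lookup H u

count-point : ∀ {n} (H : Vec Bool n) (j : ℕ) (q : ℕ → Bool) →
  count (λ u → (j ≡ᵇ toℕ u) ∧ q (toℕ u)) (allFin n) ≡ onVertex (cells H j) (q j)
count-point         []      j       q = refl
count-point {suc n} (x ∷ H) zero    q = begin
  count (λ u → (0 ≡ᵇ toℕ u) ∧ q (toℕ u)) (allFin (suc n))
    ≡⟨ count-allFin-suc {n} (λ u → (0 ≡ᵇ toℕ u) ∧ q (toℕ u)) ⟩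
  bit (q 0) + count (λ _ → false) (allFin n)
    ≡⟨ cong (bit (q 0) +_) (count-false (allFin n)) ⟩
  bit (q 0) + 0
    ≡⟨ +-identityʳ _ ⟩
  bit (q 0)
    ∎
  where open ≡-Reasoning
count-point {suc n} (x ∷ H) (suc j) q =
  trans (count-allFin-suc {n} (λ u → (suc j ≡ᵇ toℕ u) ∧ q (toℕ u))) (count-point H j (q ∘ suc))

≡ᵇ-sym : ∀ m n → (m ≡ᵇ n) ≡ (n ≡ᵇ m)
≡ᵇ-sym m n = does-⇔ (mk⇔ sym sym) (m ℕ.≟ n) (n ℕ.≟ m)

does-≟-true : ∀ b → does (b Bool.≟ true) ≡ b
does-≟-true false = refl
does-≟-true true  = refl

bit-∧-disjoint-∨ : ∀ c a b → (a ∧ b) ≡ false → bit (c ∧ (a ∨ b)) ≡ bit (b ∧ c) + bit (a ∧ c)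
bit-∧-disjoint-∨ false false false _ = refl
bit-∧-disjoint-∨ false false true  _ = refl
bit-∧-disjoint-∨ false true  false _ = refl
bit-∧-disjoint-∨ false true  true  _ = refl
bit-∧-disjoint-∨ true  false false _ = refl
bit-∧-disjoint-∨ true  false true  _ = refl
bit-∧-disjoint-∨ true  true  false _ = refl

suc≡ᵇ∧suc≡ᵇ≡false : ∀ t i → ((suc t ≡ᵇ i) ∧ (suc i ≡ᵇ t)) ≡ false
suc≡ᵇ∧suc≡ᵇ≡false zero    i       = ∧-zeroʳ (1 ≡ᵇ i)
suc≡ᵇ∧suc≡ᵇ≡false (suc t) zero    = refl
suc≡ᵇ∧suc≡ᵇ≡false (suc t) (suc i) = suc≡ᵇ∧suc≡ᵇ≡false t i

count-predecessor : ∀ {n} (H : Vec Bool n) (t : ℕ) (q : ℕ → Bool) →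
  count (λ u → (suc (toℕ u) ≡ᵇ t) ∧ q (2 + toℕ u)) (allFin n) ≡ onVertex (padded H (1 + t)) (q (1 + t))
count-predecessor {n} H zero    q = count-false (allFin n)
count-predecessor {n} H (suc w) q =
  trans (count-cong (λ u → cong (_∧ q (2 + toℕ u)) (≡ᵇ-sym (toℕ u) w)) (allFin n))
        (count-point H w (q ∘ (2 +_)))

countNbrs-path : ∀ {n} (H : Vec Bool n) (v : Fin n) (p : Fin n → Bool) (q : ℕ → Bool) →
  (∀ u → p u ≡ q (2 + toℕ u)) →
  countNbrs (P n) v p
    ≡ onVertex (padded H (1 + toℕ v)) (q (1 + toℕ v)) + onVertex (padded H (3 + toℕ v)) (q (3 + toℕ v))
countNbrs-path {n} H v p q p≗q = begin
  countNbrs (P n) v p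
    ≡⟨ length-filter≡count (adj? (P n) v) (filter (λ u → p u Bool.≟ true) (allFin n)) ⟩
  count (does ∘ adj? (P n) v) (filter (λ u → p u Bool.≟ true) (allFin n))
    ≡⟨ count-filter (λ u → p u Bool.≟ true) (does ∘ adj? (P n) v) (allFin n) ⟩
  count (λ u → does (p u Bool.≟ true) ∧ does (adj? (P n) v u)) (allFin n)
    ≡⟨ count-+ _ left right split (allFin n) ⟩
  count left (allFin n) + count right (allFin n)
    ≡⟨ cong₂ _+_ (count-predecessor H t q) (count-point H (suc t) (q ∘ (2 +_))) ⟩
  onVertex (padded H (1 + t)) (q (1 + t)) + onVertex (padded H (3 + t)) (q (3 + t))
    ∎
  where
  open ≡-Reasoning
  t : ℕ
  t = toℕ v
  left right : Fin n → Bool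
  left  u = (suc (toℕ u) ≡ᵇ t) ∧ q (2 + toℕ u)
  right u = (suc t ≡ᵇ toℕ u) ∧ q (2 + toℕ u)
  split : ∀ u → bit (does (p u Bool.≟ true) ∧ does (adj? (P n) v u)) ≡ bit (left u) + bit (right u)
  split u rewrite does-≟-true (p u) | p≗q u =
    bit-∧-disjoint-∨ (q (2 + toℕ u)) (suc t ≡ᵇ toℕ u) (suc (toℕ u) ≡ᵇ t)
                     (suc≡ᵇ∧suc≡ᵇ≡false t (toℕ u))

localPerturb : Cell → Cell → Cell → ℤ
localPerturb a b c =
  ℤ.+ (onVertex a (member a) + onVertex c (member c))
  ℤ.- (if member b then ℤ.+ (onVertex a true + onVertex c true) else ℤ.+ 0)

localFire : Cell → Cell → Cell → Cell → Cell → ℤ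
localFire a b c d e =
  (pc ℤ.+ ℤ.+ (onVertex b (does (pc <? pl)) + onVertex d (does (pc <? pr))))
  ℤ.- ℤ.+ (onVertex b (does (pl <? pc)) + onVertex d (does (pr <? pc)))
  where
  pl = localPerturb a b c
  pc = localPerturb b c d
  pr = localPerturb c d e

perturb-path : ∀ {n} (H : Vec Bool n) (u : Fin n) →
  perturb (P n) H u ≡ localPerturb (padded H (1 + toℕ u)) (padded H (2 + toℕ u)) (padded H (3 + toℕ u))
perturb-path {n} H u =
  cong₂ ℤ._-_ (cong ℤ.+_ (countNbrs-path H u (lookup H) (member ∘ padded H) memberAt))
              (cong₂ (λ b k → if b then ℤ.+ k else ℤ.+ 0)
                     (memberAt u) (countNbrs-path H u (λ _ → true) (λ _ → true) (λ _ → refl)))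
  where
  memberAt : ∀ w → lookup H w ≡ member (padded H (2 + toℕ w))
  memberAt w = cong member (sym (cells-lookup H w))

fire-path : ∀ {n} (H : Vec Bool n) (v : Fin n) → let s = padded H; t = toℕ v in
  fire (P n) (perturb (P n) H) v ≡ localFire (s t) (s (1 + t)) (s (2 + t)) (s (3 + t)) (s (4 + t))
fire-path {n} H v =
  cong₂ ℤ._-_
    (cong₂ ℤ._+_ (perturb-path H v) (cong ℤ.+_ (countNbrs-path H v _ (λ j → does (pv <? perturbAt j)) below)))
    (cong ℤ.+_ (countNbrs-path H v _ (λ j → does (perturbAt j <? pv)) above))
  where
  s : ℕ → Cell
  s = padded H
  -- Position 0 is never next to a vertex, so the value chosen there is irrelevant.
  perturbAt : ℕ → ℤ
  perturbAt zero    = ℤ.+ 0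
  perturbAt (suc j) = localPerturb (s j) (s (suc j)) (s (suc (suc j)))
  pv : ℤ
  pv = perturbAt (2 + toℕ v)
  below : ∀ u → does (perturb (P n) H v <? perturb (P n) H u) ≡ does (pv <? perturbAt (2 + toℕ u))
  below u = cong₂ (λ x y → does (x <? y)) (perturb-path H v) (perturb-path H u)
  above : ∀ u → does (perturb (P n) H u <? perturb (P n) H v) ≡ does (perturbAt (2 + toℕ u) <? pv)
  above u = cong₂ (λ x y → does (x <? y)) (perturb-path H u) (perturb-path H v)

centredOK : Cell → Cell → Cell → Cell → Cell → Bool
centredOK a b nothing    d e = true
centredOK a b c@(just _) d e = isYes (localFire a b c d e ℤ.≟ ℤ.+ 0)

centredAt : (ℕ → Cell) → ℕ → Bool
centredAt s i = centredOK (s i) (s (1 + i)) (s (2 + i)) (s (3 + i)) (s (4 + i))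

windowsOK : ℕ → (ℕ → Cell) → Bool
windowsOK zero    s = true
windowsOK (suc k) s = centredAt s 0 ∧ windowsOK k (s ∘ suc)

windowsOK⇔ : ∀ k s → T (windowsOK k s) ⇔ (∀ (i : Fin k) → T (centredAt s (toℕ i)))
windowsOK⇔ zero    s = mk⇔ (λ _ ()) (λ _ → tt)
windowsOK⇔ (suc k) s = mk⇔ to from
  where
  to : T (windowsOK (suc k) s) → ∀ i → T (centredAt s (toℕ i))
  to w fzero    = proj₁ (Equivalence.to T-∧ w)
  to w (fsuc i) = Equivalence.to (windowsOK⇔ k (s ∘ suc)) (proj₂ (Equivalence.to T-∧ w)) i
  from : (∀ i → T (centredAt s (toℕ i))) → T (windowsOK (suc k) s)
  from f = Equivalence.from T-∧ (f fzero , Equivalence.from (windowsOK⇔ k (s ∘ suc)) (f ∘ fsuc))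

centredAt-vertex : ∀ {n} (H : Vec Bool n) (v : Fin n) → let s = padded H; t = toℕ v in
  T (centredAt s t) ⇔ (localFire (s t) (s (1 + t)) (s (2 + t)) (s (3 + t)) (s (4 + t)) ≡ ℤ.+ 0)
centredAt-vertex H v rewrite cells-lookup H v = mk⇔ toWitness fromWitness

zeroTwoInvoking⇔windowsOK : ∀ {n} (H : Vec Bool n) → ZeroTwoInvoking (P n) H ⇔ T (windowsOK n (padded H))
zeroTwoInvoking⇔windowsOK {n} H = mk⇔
  (λ inv → Equivalence.from (windowsOK⇔ n (padded H))
             (λ v → Equivalence.from (centredAt-vertex H v) (trans (sym (fire-path H v)) (inv v))))
  (λ ok v → trans (fire-path H v)
              (Equivalence.to (centredAt-vertex H v) (Equivalence.to (windowsOK⇔ n (padded H)) ok v)))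

does-zeroTwoInvoking?≡windowsOK : ∀ {n} (H : Vec Bool n) → does (zeroTwoInvoking? (P n) H) ≡ windowsOK n (padded H)
does-zeroTwoInvoking?≡windowsOK {n} H = does-⇔ (zeroTwoInvoking⇔windowsOK H) (zeroTwoInvoking? (P n) H) (T? _)

-- The last four positions read, the newest of which is a vertex; dead once a window fails.
data State : Set where
  dead : State
  live : Cell → Cell → Cell → Bool → State

step : State → Bool → State
step dead           _ = dead
step (live a b c d) x = if centredOK a b c (just d) (just x) then live b c (just d) x else dead

final : State → Bool
final dead           = false
final (live a b c d) = centredOK a b c (just d) nothing ∧ centredOK b c (just d) nothing nothing

open Automaton step final

accepts-dead : ∀ {m} (H : Vec Bool m) → accepts dead H ≡ false
accepts-dead []      = refl
accepts-dead (x ∷ H) = accepts-dead H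

accepts-live : ∀ {m} a b c d (H : Vec Bool m) →
  accepts (live a b c d) H ≡ windowsOK (2 + m) (a ◂ b ◂ c ◂ just d ◂ cells H)
accepts-live a b c d [] = cong (centredOK a b c (just d) nothing ∧_) (sym (∧-identityʳ _))
accepts-live a b c d (x ∷ H) with centredOK a b c (just d) (just x)
... | true  = accepts-live b c (just d) x H
... | false = accepts-dead H

does-zeroTwoInvoking?≡accepts : ∀ {k} x (H : Vec Bool k) →
  does (zeroTwoInvoking? (P (suc k)) (x ∷ H)) ≡ accepts (live nothing nothing nothing x) H
does-zeroTwoInvoking?≡accepts x H =
  trans (does-zeroTwoInvoking?≡windowsOK (x ∷ H)) (sym (accepts-live nothing nothing nothing x H))

allBool : (Bool → Bool) → Bool
allBool p = p true ∧ p false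

allCell : (Cell → Bool) → Bool
allCell p = p nothing ∧ allBool (p ∘ just)

allStates : (State → Bool) → Bool
allStates p = p dead ∧ allCell λ a → allCell λ b → allCell λ c → allBool λ d → p (live a b c d)

allBool-sound : ∀ p → T (allBool p) → ∀ b → T (p b)
allBool-sound p t true  = proj₁ (Equivalence.to (T-∧ {p true}) t)
allBool-sound p t false = proj₂ (Equivalence.to (T-∧ {p true}) t)

allCell-sound : ∀ p → T (allCell p) → ∀ c → T (p c)
allCell-sound p t nothing  = proj₁ (Equivalence.to (T-∧ {p nothing}) t)
allCell-sound p t (just b) = allBool-sound (p ∘ just) (proj₂ (Equivalence.to (T-∧ {p nothing}) t)) b

allStates-sound : ∀ p → T (allStates p) → ∀ s → T (p s)
allStates-sound p t dead = proj₁ (Equivalence.to (T-∧ {p dead}) t)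
allStates-sound p t (live a b c d) =
  allBool-sound (λ d → p (live a b c d))
    (allCell-sound (λ c → allBool λ d → p (live a b c d))
      (allCell-sound (λ b → allCell λ c → allBool λ d → p (live a b c d))
        (allCell-sound (λ a → allCell λ b → allCell λ c → allBool λ d → p (live a b c d))
          (proj₂ (Equivalence.to (T-∧ {p dead}) t)) a) b) c) d

decideForAllStates : {Q : State → Set} (Q? : Decidable Q) → T (allStates (isYes ∘ Q?)) → ∀ s → Q s
decideForAllStates Q? t s = toWitness (allStates-sound (isYes ∘ Q?) t s)

-- A count α + β F_m + γ F_{m+1} takes the values α + γ, α + β + γ, α + β + 2γ at m = 0, 1, 2.
form : State → FibForm
form s = (w₀ ∸ γ , w₁ ∸ w₀ , γ)
  where
  w₀ w₁ γ : ℕ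
  w₀ = acceptCount 0 s
  w₁ = acceptCount 1 s
  γ  = acceptCount 2 s ∸ w₁

form-base : ∀ s → acceptCount 0 s ≡ ⟦ form s ⟧ 0
form-base = decideForAllStates (λ s → acceptCount 0 s ℕ.≟ ⟦ form s ⟧ 0) tt

form-recurrence : ∀ s → form (step s true) ⊕ form (step s false) ≡ shift (form s)
form-recurrence =
  decideForAllStates
    (λ s → ≡-dec ℕ._≟_ (≡-dec ℕ._≟_ ℕ._≟_) (form (step s true) ⊕ form (step s false)) (shift (form s))) tt

J-suc : ∀ k → J (suc k) ≡ 2 * (fib k + 1)
J-suc k = begin
  J (suc k)
    ≡⟨ length-filter≡count (zeroTwoInvoking? (P (suc k))) (allSubsets (suc k)) ⟩
  count (does ∘ zeroTwoInvoking? (P (suc k))) (allSubsets (suc k))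
    ≡⟨ count-allSubsets-suc {k} _ ⟩
  count (does ∘ zeroTwoInvoking? (P (suc k)) ∘ (true ∷_)) (allSubsets k)
    + count (does ∘ zeroTwoInvoking? (P (suc k)) ∘ (false ∷_)) (allSubsets k)
    ≡⟨ cong₂ _+_ (count-cong (does-zeroTwoInvoking?≡accepts true) (allSubsets k))
                 (count-cong (does-zeroTwoInvoking?≡accepts false) (allSubsets k)) ⟩
  acceptCount k (live nothing nothing nothing true) + acceptCount k (live nothing nothing nothing false)
    ≡⟨ cong₂ _+_ (fibForm k _) (fibForm k _) ⟩
  ⟦ 1 , 1 , 0 ⟧ k + ⟦ 1 , 1 , 0 ⟧ k
    ≡⟨ arithmetic (fib k) (fib (suc k)) ⟩
  2 * (fib k + 1)
    ∎
  where
  open ≡-Reasoning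
  fibForm : ∀ m s → acceptCount m s ≡ ⟦ form s ⟧ m
  fibForm = acceptCount-fibForm form form-base form-recurrence
  arithmetic : ∀ f f′ → (1 + 1 * f + 0 * f′) + (1 + 1 * f + 0 * f′) ≡ 2 * (f + 1)
  arithmetic = solve-∀

mainTheorem10 : ∀ (k : ℕ) → J (k + 1) ≡ 2 * (fib k + 1)
mainTheorem10 k rewrite +-comm k 1 = J-suc k
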